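{- Let $q\ge 2$ and $n\ge 1$ be integers and let $S=(s_i)$ be an orientable sequence of order $n$ over $\mathbb{Z}_q$ with period $m$ and ring sequence $[s_0,\dots,s_{m-1}]$. Then: (i) if $m$ is odd and $q$ is odd, $A^{ -1}(S)$ consists of one orientable sequence of order $n+1$ and period $m$, together with two shifts of each of $\frac{q-1}{2}$ orientable sequences of order $n+1$ and period $2m$ which are alternating sign translates of one another; (ii) if $m$ is odd, $q$ is even and $2x=w^A_q(S)$ for some $x\in\mathbb{Z}_q$, $A^{ -1}(S)$ consists of two orientable sequences of order $n+1$ and period $m$ which are alternating sign translates of each other, together with two shifts of each of $\frac{q-2}{2}$ orientable sequences of order $n+1$ and period $2m$ which are alternating sign translates of each other; (iii) if $m$ is odd, $q$ is even and there is no $x\in\mathbb{Z}_q$ with $2x=w^A_q(S)$, $A^{ -1}(S)$ consists of two shifts of each of $\frac{q}{2}$ orientable sequences of order $n+1$ and period $2m$ which are alternating sign translates of each other; (iv) if $m$ is even and $w^A_q(S)$ has additive order $h$ in $\mathbb{Z}_q$, $A^{ -1}(S)$ consists of $h$ shifts of each of $\frac{q}{h}$ mutually o-disjoint orientable sequences of order $n+1$ and period $hm$ which are alternating sign translates of one another.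
   Context: Sequences are periodic over $\mathbb{Z}_q$; period means least period. For $S=(s_i)$ of period $m$, $\mathbf{s}_n(i)=(s_i,\dots,s_{i+n-1})$. For $\mathbf{u}=(u_0,\dots,u_{n-1})$, $\mathbf{u}^R=(u_{n-1},\dots,u_0)$. $S$ is an orientable sequence of order $n$ if $\mathbf{s}_n(i)=\mathbf{s}_n(j)$ implies $i\equiv j\pmod m$ and $\mathbf{s}_n(i)\neq\mathbf{s}_n(j)^R$ for all $i,j$. Two such sequences $S,S'$ are o-disjoint if $\mathbf{s}_n(i)\neq\mathbf{s}'_n(j)$ and $\mathbf{s}_n(i)\neq\mathbf{s}'_n(j)^R$ for all $i,j$. The alternating sign weight is $w^A_q(S)=\sum_{i=0}^{m-1}(-1)^{m-1-i}s_i \bmod q$, computed from the ring sequence $[s_0,\dots,s_{m-1}]$. $A$ maps a periodic sequence $(t_i)$ to $(t_i+t_{i+1})$, and $A^{ -1}(S)$ is the set of all periodic sequences $T$ with $A(T)=S$. A shift of $(t_i)$ is $(t_{i+k})$; an alternating sign translate of $(t_i)$ is a sequence $(t_i+(-1)^i c)$ for some nonzero $c\in\mathbb{Z}_q$. -}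

module Defs where

open import Data.Nat using (ℕ; zero; suc; _+_; _*_; _∸_; _≤_; _<_; NonZero; ∣_-_∣)
open import Data.Nat.DivMod using (_%_; m%n<n)
open import Data.Nat.Divisibility using (_∣_)
open import Data.Fin using (Fin; toℕ; fromℕ<)
open import Data.Vec using (Vec; tabulate; reverse)
open import Data.Product using (Σ; ∃; _×_; _,_)
open import Data.Sum using (_⊎_)
open import Relation.Nullary using (¬_)
open import Relation.Binary.PropositionalEquality using (_≡_; _≢_; _≗_)

-- Periodic sequences over ℤ_q are modelled as functions ℕ → Fin q
-- (Fin q = ℤ_q, arithmetic modulo q).
Seq : ℕ → Set
Seq q = ℕ → Fin q

IsPeriod : ∀ {q} → ℕ → Seq q → Set
IsPeriod p t = 0 < p × (∀ i → t (i + p) ≡ t i)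

Periodic : ∀ {q} → Seq q → Set
Periodic t = ∃ λ p → IsPeriod p t

HasPeriod : ∀ {q} → ℕ → Seq q → Set
HasPeriod m t = IsPeriod m t × (∀ p → IsPeriod p t → m ≤ p)

window : ∀ {q} → (n : ℕ) → Seq q → ℕ → Vec (Fin q) n
window n t i = tabulate (λ k → t (i + toℕ k))

IsOrientable : ∀ {q} → ℕ → ℕ → Seq q → Set
IsOrientable n m s =
  HasPeriod m s
  × (∀ i j → window n s i ≡ window n s j → m ∣ ∣ i - j ∣)
  × (∀ i j → window n s i ≢ reverse (window n s j))

ODisjoint : ∀ {q} → ℕ → Seq q → Seq q → Set
ODisjoint n s s' =
  ∀ i j → window n s i ≢ window n s' j × window n s i ≢ reverse (window n s' j)

shift : ∀ {q} → ℕ → Seq q → Seq q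
shift k t i = t (k + i)

module _ {q : ℕ} .{{_ : NonZero q}} where

  0q : Fin q
  0q = fromℕ< (m%n<n 0 q)

  _+q_ : Fin q → Fin q → Fin q
  a +q b = fromℕ< (m%n<n (toℕ a + toℕ b) q)

  -q_ : Fin q → Fin q
  -q a = fromℕ< (m%n<n (q ∸ toℕ a) q)

  altSign : ℕ → Fin q → Fin q
  altSign zero c = c
  altSign (suc i) c = -q (altSign i c)

  sumq : ℕ → (ℕ → Fin q) → Fin q
  sumq zero f = 0q
  sumq (suc k) f = sumq k f +q f k

  altWeight : ℕ → Seq q → Fin q
  altWeight m s = sumq m (λ i → altSign (m ∸ 1 ∸ i) (s i))

  IsAddOrder : ℕ → Fin q → Set
  IsAddOrder h w = 0 < h × q ∣ h * toℕ w × (∀ k → 0 < k → q ∣ k * toℕ w → h ≤ k)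

  A : Seq q → Seq q
  A t i = t i +q t (suc i)

  InvA : Seq q → Seq q → Set
  InvA s t = Periodic t × (A t ≗ s)

  AltTranslate : Seq q → Seq q → Set
  AltTranslate t u = Σ (Fin q) λ c → c ≢ 0q × (∀ i → u i ≡ t i +q altSign i c)

  -- A⁻¹(S) consists exactly of the pairwise distinct sequences L x, x : I
  ListsPreimage : (I : Set) → Seq q → (I → Seq q) → Set
  ListsPreimage I s L =
    (∀ x y → L x ≗ L y → x ≡ y)
    × (∀ x → InvA s (L x))
    × (∀ t → InvA s t → ∃ λ x → t ≗ L x)

  -- the listing (j , l) ↦ shift (a j l) (U j): r shifts of each U j
  shiftList : ∀ {k r : ℕ} → (Fin k → Seq q) → (Fin k → Fin r → ℕ) → Fin k × Fin r → Seq q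
  shiftList U a (j , l) = shift (a j l) (U j)

-- A preimage T of S under A is determined by T₀: T i = B i + (-1)^i T₀, where B is the
-- preimage with B₀ = 0, so A⁻¹(S) is a copy of ℤ_q. Shifting T by the period m of S yields the preimage
-- with initial value F(T₀) = w + (-1)^m T₀, where w = B m = w^A_q(S). Since A is local, equal or
-- reversed (n+1)-windows of preimages give equal or reversed n-windows of S; hence every preimage is
-- orientable, its least period is m times the length of the F-orbit of T₀, and two preimages share a
-- window only if their initial values lie in the same F-orbit. For m odd, F c = w - c is an involution
-- whose fixed points are the halves of w; for m even, F c = w + c is a translation whose orbits have
-- length h = ord(w) and are the classes modulo q/h. Listing the orbits injectively by representatives
-- and shifts exhausts ℤ_q by counting.

module Submission where

open import Defs
open import Algebra.Bundles using (AbelianGroup)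
open import Algebra.Structures using (IsAbelianGroup)
open import Data.Empty using (⊥)
open import Data.Fin using (Fin; zero; suc; toℕ; punchOut)
open import Data.Fin.Properties
  using (toℕ-injective; toℕ<n; toℕ-fromℕ<; any?; _≟_; punchOut-injective; injective⇒≤; +↔⊎; *↔×; 1↔⊤; 0↔⊥)
open import Data.Nat
  using (ℕ; zero; suc; _+_; _*_; _∸_; _≤_; _<_; z≤n; s≤s; z<s; s<s; ∣_-_∣; NonZero; >-nonZero; >-nonZero⁻¹)
open import Data.Nat.DivMod
  using ( _%_; _/_; _mod_; m%n<n; %-distribˡ-+; m<n⇒m%n≡m; m≡m%n+[m/n]*n; m∣n⇒o%n%m≡o%m; %-remove-+ˡ
        ; m/n*n≡m; m≥n⇒m/n>0; m/n<m)
open import Data.Nat.Divisibility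
  using ( _∣_; divides; ∣⇒≤; _∣0; ∣-refl; ∣-reflexive; ∣-trans; 1∣_; m∣m*n; n∣m*n; ∣m∣n⇒∣m+n; ∣m+n∣m⇒∣n
        ; %-presˡ-∣; *-cancelʳ-∣; *-monoˡ-∣; m%n≡0⇒n∣m; n∣m⇒m%n≡0)
open import Data.Nat.GeneralisedArithmetic using (iterate)
open import Data.Nat.Properties
  using ( +-comm; +-assoc; +-identityʳ; +-suc; *-comm; *-assoc; *-identityˡ; *-distribʳ-+; suc-injective
        ; ≤-trans; ≤-reflexive; ≤-total; <-trans; ≤-<-trans; <⇒≤; <⇒≱; 1+n≰n; n<1+n; m<n⇒m<1+n; m≤n⇒m≤1+n
        ; m≤m+n; m<m+n; m≤m*n; +-mono-≤; +-mono-≤-<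
        ; n∸n≡0; m∸n≤m; m∸n+n≡m; m+[n∸m]≡n; +-∸-assoc; ∣-∣-comm; m≤n⇒∣m-n∣≡n∸m)
open import Data.Product using (Σ; ∃; _×_; _,_; proj₁; proj₂)
open import Data.Sum using (_⊎_; inj₁; inj₂; [_,_]; [_,_]′)
open import Data.Sum.Function.Propositional using (_⊎-↔_)
open import Data.Sum.Properties using (inj₂-injective)
open import Data.Unit using (⊤; tt)
open import Data.Vec using (Vec; tabulate; reverse; _∷_; _∷ʳ_)
open import Data.Vec.Properties using (tabulate-cong; ∷-injectiveˡ; ∷-injectiveʳ; reverse-∷)
open import Function using (id; const; _∘_; Injective; Inverse; _↔_)
open import Function.Properties.Inverse using (↔-refl; ↔-trans)
open import Level using (0ℓ)
open import Relation.Nullary using (¬_; yes; no; contradiction)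
open import Relation.Binary.PropositionalEquality hiding ([_])

n*2≡n+n : ∀ n → n * 2 ≡ n + n
n*2≡n+n n = trans (*-comm n 2) (cong (n +_) (+-identityʳ n))

odd-split : ∀ x → x % 2 ≡ 1 → x ≡ 1 + (x ∸ 1) / 2 * 2
odd-split zero    ()
odd-split (suc x) x+1-odd = cong suc (sym (m/n*n≡m (m%n≡0⇒n∣m x 2 (pred-even x x+1-odd))))
  where
  pred-even : ∀ x → suc x % 2 ≡ 1 → x % 2 ≡ 0
  pred-even zero          _  = refl
  pred-even (suc zero)    ()
  pred-even (suc (suc x)) e  = pred-even x e

even-split₂ : ∀ x → 2 ≤ x → x % 2 ≡ 0 → x ≡ 2 + (x ∸ 2) / 2 * 2
even-split₂ (suc (suc x)) _ x-even = cong (2 +_) (sym (m/n*n≡m (m%n≡0⇒n∣m x 2 x-even)))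

pair-sum-≤ : ∀ {H a b} → a < H → b < H → suc a + suc b ≤ H * 2
pair-sum-≤ {H} a<H b<H = ≤-trans (+-mono-≤ a<H b<H) (≤-reflexive (sym (n*2≡n+n H)))

-- ℤ_q as an abelian group

module _ {q : ℕ} .{{_ : NonZero q}} where

  toℕ-mod : ∀ n → toℕ (n mod q) ≡ n % q
  toℕ-mod n = toℕ-fromℕ< (m%n<n n q)

  mod-cong : ∀ {a b} → a % q ≡ b % q → a mod q ≡ b mod q
  mod-cong {a} {b} e = toℕ-injective (trans (toℕ-mod a) (trans e (sym (toℕ-mod b))))

  mod-toℕ : (a : Fin q) → toℕ a mod q ≡ a
  mod-toℕ a = toℕ-injective (trans (toℕ-mod (toℕ a)) (m<n⇒m%n≡m (toℕ<n a)))

  mod-homo-+ : ∀ a b → (a + b) mod q ≡ (a mod q) +q (b mod q)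
  mod-homo-+ a b = mod-cong (begin
    (a + b) % q                         ≡⟨ %-distribˡ-+ a b q ⟩
    (a % q + b % q) % q                 ≡⟨ cong₂ (λ x y → (x + y) % q) (toℕ-mod a) (toℕ-mod b) ⟨
    (toℕ (a mod q) + toℕ (b mod q)) % q ∎)
    where open ≡-Reasoning

  toℕ-0q : toℕ (0q {q}) ≡ 0
  toℕ-0q = trans (toℕ-mod 0) (m<n⇒m%n≡m (>-nonZero⁻¹ q))

  mod≡0q⇒∣ : ∀ {n} → n mod q ≡ 0q → q ∣ n
  mod≡0q⇒∣ {n} e = m%n≡0⇒n∣m n q (trans (sym (toℕ-mod n)) (trans (cong toℕ e) toℕ-0q))

  ∣⇒mod≡0q : ∀ {n} → q ∣ n → n mod q ≡ 0q
  ∣⇒mod≡0q {n} d = toℕ-injective (trans (toℕ-mod n) (trans (n∣m⇒m%n≡0 n q d) (sym toℕ-0q)))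

  +q-assoc : ∀ (a b c : Fin q) → (a +q b) +q c ≡ a +q (b +q c)
  +q-assoc a b c = begin
    (a +q b) +q c                   ≡⟨ cong ((a +q b) +q_) (mod-toℕ c) ⟨
    ((a′ + b′) mod q) +q (c′ mod q) ≡⟨ mod-homo-+ (a′ + b′) c′ ⟨
    (a′ + b′ + c′) mod q            ≡⟨ cong (_mod q) (+-assoc a′ b′ c′) ⟩
    (a′ + (b′ + c′)) mod q          ≡⟨ mod-homo-+ a′ (b′ + c′) ⟩
    (a′ mod q) +q ((b′ + c′) mod q) ≡⟨ cong (_+q (b +q c)) (mod-toℕ a) ⟩
    a +q (b +q c)                   ∎
    where
    open ≡-Reasoning
    a′ b′ c′ : ℕ
    a′ = toℕ a
    b′ = toℕ b
    c′ = toℕ c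

  +q-comm : ∀ (a b : Fin q) → a +q b ≡ b +q a
  +q-comm a b = cong (_mod q) (+-comm (toℕ a) (toℕ b))

  +q-identityˡ : ∀ (a : Fin q) → 0q +q a ≡ a
  +q-identityˡ a = begin
    0q +q a             ≡⟨ cong (0q +q_) (mod-toℕ a) ⟨
    0q +q (toℕ a mod q) ≡⟨ mod-homo-+ 0 (toℕ a) ⟨
    toℕ a mod q         ≡⟨ mod-toℕ a ⟩
    a                   ∎
    where open ≡-Reasoning

  -q-inverseˡ : ∀ (a : Fin q) → (-q a) +q a ≡ 0q
  -q-inverseˡ a = begin
    (-q a) +q a                          ≡⟨ cong ((-q a) +q_) (mod-toℕ a) ⟨
    ((q ∸ toℕ a) mod q) +q (toℕ a mod q) ≡⟨ mod-homo-+ (q ∸ toℕ a) (toℕ a) ⟨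
    (q ∸ toℕ a + toℕ a) mod q            ≡⟨ cong (_mod q) (m∸n+n≡m (<⇒≤ (toℕ<n a))) ⟩
    q mod q                              ≡⟨ ∣⇒mod≡0q ∣-refl ⟩
    0q                                   ∎
    where open ≡-Reasoning

  +q-isAbelianGroup : IsAbelianGroup _≡_ _+q_ 0q -q_
  +q-isAbelianGroup = record
    { isGroup = record
      { isMonoid = record
        { isSemigroup = record
          { isMagma = record { isEquivalence = isEquivalence ; ∙-cong = cong₂ _+q_ }
          ; assoc = +q-assoc }
        ; identity = +q-identityˡ , λ a → trans (+q-comm a 0q) (+q-identityˡ a) }
      ; inverse = -q-inverseˡ , λ a → trans (+q-comm a (-q a)) (-q-inverseˡ a)
      ; ⁻¹-cong = cong -q_ }
    ; comm = +q-comm }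

  ℤ-abelianGroup : AbelianGroup 0ℓ 0ℓ
  ℤ-abelianGroup = record { isAbelianGroup = +q-isAbelianGroup }

  open AbelianGroup ℤ-abelianGroup public
    using () renaming (identityʳ to +q-identityʳ; inverseʳ to -q-inverseʳ)
  open import Algebra.Properties.AbelianGroup ℤ-abelianGroup public
    using ( ∙-cancelˡ; ∙-cancelʳ; \\-leftDividesˡ; //-rightDividesˡ; //-rightDividesʳ
          ; ⁻¹-involutive; ⁻¹-injective; ε⁻¹≈ε; ⁻¹-∙-comm; inverseˡ-unique)
  open import Algebra.Properties.CommutativeSemigroup (AbelianGroup.commutativeSemigroup ℤ-abelianGroup) public
    using (interchange)
  open import Algebra.Properties.Monoid.Mult (AbelianGroup.monoid ℤ-abelianGroup) public
    using (×-homo-+; ×-homo-1) renaming (_×_ to _×q_)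

  mod-homo-* : ∀ t n → (t * n) mod q ≡ t ×q (n mod q)
  mod-homo-* zero n = refl
  mod-homo-* (suc t) n = trans (mod-homo-+ n (t * n)) (cong ((n mod q) +q_) (mod-homo-* t n))

  ×q-toℕ : ∀ t (a : Fin q) → t ×q a ≡ (t * toℕ a) mod q
  ×q-toℕ t a = trans (cong (t ×q_) (sym (mod-toℕ a))) (sym (mod-homo-* t (toℕ a)))

  ×q≡0q⇒∣ : ∀ t (a : Fin q) → t ×q a ≡ 0q → q ∣ t * toℕ a
  ×q≡0q⇒∣ t a e = mod≡0q⇒∣ (trans (sym (×q-toℕ t a)) e)

  ∣⇒×q≡0q : ∀ t (a : Fin q) → q ∣ t * toℕ a → t ×q a ≡ 0q
  ∣⇒×q≡0q t a d = trans (×q-toℕ t a) (∣⇒mod≡0q d)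

  altSign-homo-+ : ∀ i (a b : Fin q) → altSign i (a +q b) ≡ altSign i a +q altSign i b
  altSign-homo-+ zero a b = refl
  altSign-homo-+ (suc i) a b =
    trans (cong -q_ (altSign-homo-+ i a b)) (sym (⁻¹-∙-comm (altSign i a) (altSign i b)))

  altSign-injective : ∀ i {a b : Fin q} → altSign i a ≡ altSign i b → a ≡ b
  altSign-injective zero e = e
  altSign-injective (suc i) e = altSign-injective i (⁻¹-injective e)

  altSign-mod2 : ∀ i (c : Fin q) → altSign i c ≡ altSign (i % 2) c
  altSign-mod2 zero c = refl
  altSign-mod2 (suc zero) c = refl
  altSign-mod2 (suc (suc i)) c = trans (⁻¹-involutive (altSign i c)) (altSign-mod2 i c)

  sumq-cong : ∀ k {f g : ℕ → Fin q} → (∀ i → i < k → f i ≡ g i) → sumq k f ≡ sumq k g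
  sumq-cong zero e = refl
  sumq-cong (suc k) e = cong₂ _+q_ (sumq-cong k (λ i i<k → e i (m<n⇒m<1+n i<k))) (e k (n<1+n k))

  sumq-neg : ∀ k (f : ℕ → Fin q) → sumq k (λ i → -q (f i)) ≡ -q (sumq k f)
  sumq-neg zero f = sym ε⁻¹≈ε
  sumq-neg (suc k) f = trans (cong (_+q (-q (f k))) (sumq-neg k f)) (⁻¹-∙-comm (sumq k f) (f k))

  mod-injective : ∀ {a b} → a < q → b < q → a mod q ≡ b mod q → a ≡ b
  mod-injective {a} {b} a<q b<q e = begin
    a             ≡⟨ m<n⇒m%n≡m a<q ⟨
    a % q         ≡⟨ toℕ-mod a ⟨
    toℕ (a mod q) ≡⟨ cong toℕ e ⟩
    toℕ (b mod q) ≡⟨ toℕ-mod b ⟩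
    b % q         ≡⟨ m<n⇒m%n≡m b<q ⟩
    b             ∎
    where open ≡-Reasoning

  mod≢0q : ∀ {s} → 0 < s → s < q → s mod q ≢ 0q
  mod≢0q 0<s s<q e = <⇒≱ s<q (∣⇒≤ {{>-nonZero 0<s}} (mod≡0q⇒∣ e))

  shifted-sum≢ : ∀ {y w : Fin q} {d s} a b → (y +q y) +q (d mod q) ≡ w → a + b ≡ d + s → 0 < s → s < q
              → (y +q (a mod q)) +q (y +q (b mod q)) ≢ w
  shifted-sum≢ {y} {w} {d} {s} a b half a+b≡d+s 0<s s<q e = mod≢0q 0<s s<q (∙-cancelˡ w (s mod q) 0q (begin
    w +q (s mod q)                       ≡⟨ cong (_+q (s mod q)) half ⟨
    ((y +q y) +q (d mod q)) +q (s mod q) ≡⟨ +q-assoc (y +q y) (d mod q) (s mod q) ⟩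
    (y +q y) +q ((d mod q) +q (s mod q)) ≡⟨ cong ((y +q y) +q_) (mod-homo-+ d s) ⟨
    (y +q y) +q ((d + s) mod q)          ≡⟨ cong (λ x → (y +q y) +q (x mod q)) a+b≡d+s ⟨
    (y +q y) +q ((a + b) mod q)          ≡⟨ cong ((y +q y) +q_) (mod-homo-+ a b) ⟩
    (y +q y) +q ((a mod q) +q (b mod q)) ≡⟨ interchange y y (a mod q) (b mod q) ⟩
    (y +q (a mod q)) +q (y +q (b mod q)) ≡⟨ e ⟩
    w                                    ≡⟨ +q-identityʳ w ⟨
    w +q 0q                              ∎))
    where open ≡-Reasoning

  odd-halving : ∀ H → q ≡ suc (H * 2) → (w : Fin q) → (suc H ×q w) +q (suc H ×q w) ≡ w
  odd-halving H q≡1+H*2 w = begin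
    (suc H ×q w) +q (suc H ×q w) ≡⟨ ×-homo-+ w (suc H) (suc H) ⟨
    (suc H + suc H) ×q w         ≡⟨ cong (_×q w) 2+H+H≡1+q ⟩
    (1 + q) ×q w                 ≡⟨ ×-homo-+ w 1 q ⟩
    (1 ×q w) +q (q ×q w)         ≡⟨ cong₂ _+q_ (×-homo-1 w) (∣⇒×q≡0q q w (m∣m*n (toℕ w))) ⟩
    w +q 0q                      ≡⟨ +q-identityʳ w ⟩
    w                            ∎
    where
    open ≡-Reasoning
    2+H+H≡1+q : suc H + suc H ≡ 1 + q
    2+H+H≡1+q = trans (cong suc (+-suc H H)) (sym (cong suc (trans q≡1+H*2 (cong suc (n*2≡n+n H)))))

  even-halving-0q : ∀ H → q ≡ suc H + suc H → (suc H mod q) +q (suc H mod q) ≡ 0q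
  even-halving-0q H q≡ = trans (sym (mod-homo-+ (suc H) (suc H))) (∣⇒mod≡0q (∣-reflexive q≡))

  mod-halving : ∀ W → (((W / 2) mod q) +q ((W / 2) mod q)) +q ((W % 2) mod q) ≡ W mod q
  mod-halving W = begin
    (((W / 2) mod q) +q ((W / 2) mod q)) +q ((W % 2) mod q) ≡⟨ cong (_+q ((W % 2) mod q)) (mod-homo-+ (W / 2) (W / 2)) ⟨
    ((W / 2 + W / 2) mod q) +q ((W % 2) mod q)              ≡⟨ mod-homo-+ (W / 2 + W / 2) (W % 2) ⟨
    (W / 2 + W / 2 + W % 2) mod q                           ≡⟨ cong (_mod q) halves ⟩
    W mod q                                                 ∎
    where
    open ≡-Reasoning
    halves : W / 2 + W / 2 + W % 2 ≡ W
    halves = trans (+-comm (W / 2 + W / 2) (W % 2))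
               (trans (cong (W % 2 +_) (sym (n*2≡n+n (W / 2)))) (sym (m≡m%n+[m/n]*n W 2)))

  order-minimal : ∀ {h} {a : Fin q} → IsAddOrder h a → ∀ {r} → r < h → q ∣ r * toℕ a → r ≡ 0
  order-minimal _                   {zero}  _   _ = refl
  order-minimal (_ , _ , minimality) {suc r} r<h q∣r*a = contradiction (minimality (suc r) z<s q∣r*a) (<⇒≱ r<h)

  order-annihilates : ∀ {h} {a : Fin q} → IsAddOrder h a → h ×q a ≡ 0q
  order-annihilates {h} {a} (_ , q∣h*a , _) = ∣⇒×q≡0q h a q∣h*a

  order-divides : ∀ {h} {a : Fin q} → IsAddOrder h a → ∀ t → t ×q a ≡ 0q → h ∣ t
  order-divides {h} {a} order@(0<h , q∣h*a , _) t t×a≡0 = m%n≡0⇒n∣m t h (order-minimal order (m%n<n t h) q∣r*a)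
    where
    instance
      _ : NonZero h
      _ = >-nonZero 0<h
    split : t * toℕ a ≡ t / h * (h * toℕ a) + t % h * toℕ a
    split = begin
      t * toℕ a                           ≡⟨ cong (_* toℕ a) (m≡m%n+[m/n]*n t h) ⟩
      (t % h + t / h * h) * toℕ a         ≡⟨ *-distribʳ-+ (toℕ a) (t % h) (t / h * h) ⟩
      t % h * toℕ a + t / h * h * toℕ a   ≡⟨ cong (t % h * toℕ a +_) (*-assoc (t / h) h (toℕ a)) ⟩
      t % h * toℕ a + t / h * (h * toℕ a) ≡⟨ +-comm (t % h * toℕ a) _ ⟩
      t / h * (h * toℕ a) + t % h * toℕ a ∎
      where open ≡-Reasoning
    q∣r*a : q ∣ t % h * toℕ a
    q∣r*a = ∣m+n∣m⇒∣n (subst (q ∣_) split (×q≡0q⇒∣ t a t×a≡0)) (∣-trans q∣h*a (n∣m*n (t / h)))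

  ×q-injective-≤-<order : ∀ {h} {a : Fin q} → IsAddOrder h a → ∀ {t t'} → t ≤ t' → t' < h
                          → t ×q a ≡ t' ×q a → t ≡ t'
  ×q-injective-≤-<order {h} {a} order {t} {t'} t≤t' t'<h e =
    trans (sym (+-identityʳ t)) (trans (cong (t +_) (sym d≡0)) (m+[n∸m]≡n t≤t'))
    where
    open ≡-Reasoning
    d≡0 : t' ∸ t ≡ 0
    d≡0 = order-minimal order (≤-<-trans (m∸n≤m t' t) t'<h) (×q≡0q⇒∣ (t' ∸ t) a (∙-cancelˡ (t ×q a) _ _ (begin
      (t ×q a) +q ((t' ∸ t) ×q a) ≡⟨ ×-homo-+ a t (t' ∸ t) ⟨
      (t + (t' ∸ t)) ×q a         ≡⟨ cong (_×q a) (m+[n∸m]≡n t≤t') ⟩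
      t' ×q a                     ≡⟨ e ⟨
      t ×q a                      ≡⟨ +q-identityʳ (t ×q a) ⟨
      (t ×q a) +q 0q              ∎)))

  ×q-injective-<order : ∀ {h} {a : Fin q} → IsAddOrder h a → ∀ {t t'} → t < h → t' < h → t ×q a ≡ t' ×q a → t ≡ t'
  ×q-injective-<order order {t} {t'} t<h t'<h e with ≤-total t t'
  ... | inj₁ t≤t' = ×q-injective-≤-<order order t≤t' t'<h e
  ... | inj₂ t'≤t = sym (×q-injective-≤-<order order t'≤t t<h (sym e))

  toℕ[t×a+b]%k≡toℕ[b]%k : ∀ {k} .{{_ : NonZero k}} → k ∣ q → (a : Fin q) → k ∣ toℕ a
                          → ∀ t b → toℕ ((t ×q a) +q b) % k ≡ toℕ b % k
  toℕ[t×a+b]%k≡toℕ[b]%k {k} k∣q a k∣a t b = begin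
    toℕ ((t ×q a) +q b) % k        ≡⟨ cong (_% k) (toℕ-mod (toℕ (t ×q a) + toℕ b)) ⟩
    (toℕ (t ×q a) + toℕ b) % q % k ≡⟨ m∣n⇒o%n%m≡o%m k q _ k∣q ⟩
    (toℕ (t ×q a) + toℕ b) % k     ≡⟨ %-remove-+ˡ (toℕ b) k∣t×a ⟩
    toℕ b % k                      ∎
    where
    open ≡-Reasoning
    k∣t×a : k ∣ toℕ (t ×q a)
    k∣t×a = subst (k ∣_) (sym (trans (cong toℕ (×q-toℕ t a)) (toℕ-mod (t * toℕ a))))
              (%-presˡ-∣ (∣-trans k∣a (n∣m*n t)) k∣q)

  shifted-injective : ∀ (y : Fin q) {H} → H < q → Injective _≡_ _≡_ (λ (j : Fin H) → y +q (suc (toℕ j) mod q))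
  shifted-injective y H<q {j} {j'} e = toℕ-injective (suc-injective
    (mod-injective (≤-<-trans (toℕ<n j) H<q) (≤-<-trans (toℕ<n j') H<q) (∙-cancelˡ y _ _ e)))

-- Counting

injective⇒surjective : ∀ {N} (f : Fin N → Fin N) → Injective _≡_ _≡_ f → ∀ c → ∃ λ x → f x ≡ c
injective⇒surjective {suc N} f f-injective c with any? (λ x → f x ≟ c)
... | yes hit  = hit
... | no  miss = contradiction (injective⇒≤ g-injective) 1+n≰n
  where
  c≢f : ∀ x → c ≢ f x
  c≢f x c≡fx = miss (x , sym c≡fx)
  g : Fin (suc N) → Fin N
  g x = punchOut (c≢f x)
  g-injective : Injective _≡_ _≡_ g
  g-injective {x} {y} e = f-injective (punchOut-injective (c≢f x) (c≢f y) e)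

↔-injective⇒surjective : ∀ {N} {I : Set} → Fin N ↔ I → (φ : I → Fin N) → Injective _≡_ _≡_ φ
                         → ∀ c → ∃ λ x → φ x ≡ c
↔-injective⇒surjective e φ φ-injective c =
  let x , φ[to-x]≡c = injective⇒surjective (φ ∘ to) (λ e → to-injective (φ-injective e)) c in to x , φ[to-x]≡c
  where
  open Inverse e
  to-injective : Injective _≡_ _≡_ to
  to-injective {x} {y} tx≡ty = trans (sym (strictlyInverseʳ x)) (trans (cong from tx≡ty) (strictlyInverseʳ y))

module Involution {X : Set} (F : X → X) (F-involutive : ∀ x → F (F x) ≡ x) where

  F-injective : Injective _≡_ _≡_ F
  F-injective {x} {y} Fx≡Fy = trans (sym (F-involutive x)) (trans (cong F Fx≡Fy) (F-involutive y))

  iterate-moved-even : ∀ {x} → F x ≢ x → ∀ t → iterate F x t ≡ x → 2 ∣ t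
  iterate-moved-even     Fx≢x zero          _   = 2 ∣0
  iterate-moved-even     Fx≢x (suc zero)    Fx≡x = contradiction Fx≡x Fx≢x
  iterate-moved-even {x} Fx≢x (suc (suc t)) fix = ∣m∣n⇒∣m+n ∣-refl
    (iterate-moved-even Fx≢x t (trans (cong (λ y → iterate F y t) (sym (F-involutive x))) fix))

  module OrbitListing {K : Set} {H : ℕ} (fixed : K → X) (moved : Fin H → X)
    (fixed-injective : Injective _≡_ _≡_ fixed) (fixed-fixed : ∀ k → F (fixed k) ≡ fixed k)
    (moved-injective : Injective _≡_ _≡_ moved) (moved-apart : ∀ j j' → moved j ≢ F (moved j')) where

    orbit-listing : K ⊎ (Fin H × Fin 2) → X
    orbit-listing (inj₁ k)       = fixed k
    orbit-listing (inj₂ (j , l)) = iterate F (moved j) (toℕ l)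

    fixed≢moved : ∀ k j → fixed k ≢ moved j
    fixed≢moved k j e = moved-apart j j (trans (sym e) (trans (sym (fixed-fixed k)) (cong F e)))

    fixed≢F[moved] : ∀ k j → fixed k ≢ F (moved j)
    fixed≢F[moved] k j e = fixed≢moved k j (F-injective (trans (fixed-fixed k) e))

    orbit-listing-injective : Injective _≡_ _≡_ orbit-listing
    orbit-listing-injective {inj₁ k}              {inj₁ k'}              e = cong inj₁ (fixed-injective e)
    orbit-listing-injective {inj₁ k}              {inj₂ (j , zero)}      e = contradiction e (fixed≢moved k j)
    orbit-listing-injective {inj₁ k}              {inj₂ (j , suc zero)}  e = contradiction e (fixed≢F[moved] k j)
    orbit-listing-injective {inj₂ (j , zero)}     {inj₁ k}               e = contradiction (sym e) (fixed≢moved k j)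
    orbit-listing-injective {inj₂ (j , suc zero)} {inj₁ k}               e = contradiction (sym e) (fixed≢F[moved] k j)
    orbit-listing-injective {inj₂ (j , zero)}     {inj₂ (j' , zero)}     e = cong (λ i → inj₂ (i , zero)) (moved-injective e)
    orbit-listing-injective {inj₂ (j , zero)}     {inj₂ (j' , suc zero)} e = contradiction e (moved-apart j j')
    orbit-listing-injective {inj₂ (j , suc zero)} {inj₂ (j' , zero)}     e = contradiction (sym e) (moved-apart j' j)
    orbit-listing-injective {inj₂ (j , suc zero)} {inj₂ (j' , suc zero)} e =
      cong (λ i → inj₂ (i , suc zero)) (moved-injective (F-injective e))

-- Preimages under A

periodic-≗ : ∀ {q} {t u : Seq q} → t ≗ u → Periodic u → Periodic t
periodic-≗ t≗u (p , 0<p , u-period) = p , 0<p , λ i → trans (t≗u (i + p)) (trans (u-period i) (sym (t≗u i)))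

module Preimage {q : ℕ} .{{_ : NonZero q}} (S : Seq q) where

  particular : Seq q
  particular zero    = 0q
  particular (suc i) = (-q particular i) +q S i

  solution : Fin q → Seq q
  solution c i = particular i +q altSign i c

  A-homo-+ : ∀ (t u : Seq q) → A (λ i → t i +q u i) ≗ (λ i → A t i +q A u i)
  A-homo-+ t u i = interchange (t i) (u i) (t (suc i)) (u (suc i))

  solution-solves : ∀ c → A (solution c) ≗ S
  solution-solves c i = begin
    A (solution c) i                                     ≡⟨ A-homo-+ particular (λ j → altSign j c) i ⟩
    A particular i +q (altSign i c +q altSign (suc i) c) ≡⟨ cong₂ _+q_ A-particular (-q-inverseʳ (altSign i c)) ⟩
    S i +q 0q                                            ≡⟨ +q-identityʳ (S i) ⟩
    S i                                                  ∎
    where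
    open ≡-Reasoning
    A-particular : A particular i ≡ S i
    A-particular = \\-leftDividesˡ (particular i) (S i)

  solutions-agree : ∀ {t u : Seq q} → A t ≗ S → A u ≗ S → t 0 ≡ u 0 → t ≗ u
  solutions-agree         At Au e zero    = e
  solutions-agree {t} {u} At Au e (suc i) = ∙-cancelˡ (t i) (t (suc i)) (u (suc i)) (begin
    t i +q t (suc i) ≡⟨ At i ⟩
    S i              ≡⟨ Au i ⟨
    u i +q u (suc i) ≡⟨ cong (_+q u (suc i)) (solutions-agree {t} {u} At Au e i) ⟨
    t i +q u (suc i) ∎)
    where open ≡-Reasoning

  solution-zero : ∀ c → solution c 0 ≡ c
  solution-zero = +q-identityˡ

  solution-unique : ∀ {t : Seq q} → A t ≗ S → t ≗ solution (t 0)
  solution-unique {t} At = solutions-agree At (solution-solves (t 0)) (sym (solution-zero (t 0)))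

  solution-injective : ∀ i {c c' : Fin q} → solution c i ≡ solution c' i → c ≡ c'
  solution-injective i e = altSign-injective i (∙-cancelˡ (particular i) _ _ e)

  solution-altTranslate : ∀ {c c' : Fin q} → c ≢ c' → AltTranslate (solution c) (solution c')
  solution-altTranslate {c} {c'} c≢c' = d , d≢0 , λ i → begin
    particular i +q altSign i c'                 ≡⟨ cong (λ x → particular i +q altSign i x) (\\-leftDividesˡ c c') ⟨
    particular i +q altSign i (c +q d)           ≡⟨ cong (particular i +q_) (altSign-homo-+ i c d) ⟩
    particular i +q (altSign i c +q altSign i d) ≡⟨ +q-assoc (particular i) _ _ ⟨
    solution c i +q altSign i d                  ∎
    where
    open ≡-Reasoning
    d : Fin q
    d = (-q c) +q c'
    d≢0 : d ≢ 0q
    d≢0 d≡0 = c≢c' (⁻¹-injective (inverseˡ-unique (-q c) c' d≡0))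

  particular≡altWeight : ∀ k → particular k ≡ altWeight k S
  particular≡altWeight zero    = refl
  particular≡altWeight (suc k) = begin
    (-q particular k) +q S k
      ≡⟨ cong (λ x → (-q x) +q S k) (particular≡altWeight k) ⟩
    (-q sumq k (λ i → altSign (k ∸ 1 ∸ i) (S i))) +q S k
      ≡⟨ cong₂ _+q_ (sym (sumq-neg k _)) (sym (cong (λ j → altSign j (S k)) (n∸n≡0 k))) ⟩
    sumq k (λ i → altSign (suc (k ∸ 1 ∸ i)) (S i)) +q altSign (k ∸ k) (S k)
      ≡⟨ cong (_+q altSign (k ∸ k) (S k)) (sumq-cong k (λ i i<k → cong (λ j → altSign j (S i)) (suc[k∸1∸i] i<k))) ⟩
    sumq k (λ i → altSign (k ∸ i) (S i)) +q altSign (k ∸ k) (S k)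
      ∎
    where
    open ≡-Reasoning
    suc[k∸1∸i] : ∀ {k i} → i < k → suc (k ∸ 1 ∸ i) ≡ k ∸ i
    suc[k∸1∸i] {suc k} (s≤s i≤k) = sym (+-∸-assoc 1 i≤k)

  listsPreimage : ∀ {I : Set} (L : I → Seq q) (φ : I → Fin q) → (∀ x → L x ≗ solution (φ x))
                  → (∀ c → Periodic (solution c)) → Injective _≡_ _≡_ φ → (∀ c → ∃ λ x → φ x ≡ c)
                  → ListsPreimage I S L
  listsPreimage L φ L≗solution periodic φ-injective φ-surjective = distinct , preimage , complete
    where
    open ≡-Reasoning
    distinct : ∀ x y → L x ≗ L y → x ≡ y
    distinct x y e = φ-injective (begin
      φ x              ≡⟨ solution-zero (φ x) ⟨
      solution (φ x) 0 ≡⟨ L≗solution x 0 ⟨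
      L x 0            ≡⟨ e 0 ⟩
      L y 0            ≡⟨ L≗solution y 0 ⟩
      solution (φ y) 0 ≡⟨ solution-zero (φ y) ⟩
      φ y              ∎)
    preimage : ∀ x → InvA S (L x)
    preimage x = periodic-≗ (L≗solution x) (periodic (φ x))
               , λ i → trans (cong₂ _+q_ (L≗solution x i) (L≗solution x (suc i))) (solution-solves (φ x) i)
    complete : ∀ t → InvA S t → ∃ λ x → t ≗ L x
    complete t (_ , At) with x , φx≡t0 ← φ-surjective (t 0) =
      x , λ i → trans (solution-unique {t} At i) (trans (cong (λ c → solution c i) (sym φx≡t0)) (sym (L≗solution x i)))

listsPreimage-⊥⊎ : ∀ {q} .{{_ : NonZero q}} {I : Set} {S : Seq q} {f : ⊥ → Seq q} {L : I → Seq q}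
                   → ListsPreimage (⊥ ⊎ I) S [ f , L ] → ListsPreimage I S L
listsPreimage-⊥⊎ {f = f} {L} (distinct , preimage , complete) =
    (λ x y e → inj₂-injective (distinct (inj₂ x) (inj₂ y) e))
  , (λ x → preimage (inj₂ x))
  , λ t t∈A⁻¹S → from-inj₂ (complete t t∈A⁻¹S)
  where
  from-inj₂ : ∀ {t} → (∃ λ x → t ≗ [ f , L ] x) → ∃ λ x → t ≗ L x
  from-inj₂ (inj₂ x , t≗Lx) = x , t≗Lx

module Monodromy {q : ℕ} .{{_ : NonZero q}} (S : Seq q) {m : ℕ} (S-period : IsPeriod m S) where
  open Preimage S

  monodromy : Fin q → Fin q
  monodromy c = solution c m

  monodromy≡altWeight+altSign : ∀ c → monodromy c ≡ altWeight m S +q altSign m c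
  monodromy≡altWeight+altSign c = cong (_+q altSign m c) (particular≡altWeight m)

  shift-solution : ∀ c → shift m (solution c) ≗ solution (monodromy c)
  shift-solution c = solutions-agree A-shift (solution-solves (monodromy c))
    (trans (cong (solution c) (+-identityʳ m)) (sym (solution-zero (monodromy c))))
    where
    open ≡-Reasoning
    A-shift : A (shift m (solution c)) ≗ S
    A-shift i = begin
      solution c (m + i) +q solution c (m + suc i) ≡⟨ cong (λ j → solution c (m + i) +q solution c j) (+-suc m i) ⟩
      A (solution c) (m + i)                       ≡⟨ solution-solves c (m + i) ⟩
      S (m + i)                                    ≡⟨ cong S (+-comm m i) ⟩
      S (i + m)                                    ≡⟨ proj₂ S-period i ⟩
      S i                                          ∎

  solution-iterate : ∀ r c i → solution c (r * m + i) ≡ solution (iterate monodromy c r) i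
  solution-iterate zero    c i = refl
  solution-iterate (suc r) c i = begin
    solution c (m + r * m + i)                     ≡⟨ cong (solution c) (+-assoc m (r * m) i) ⟩
    solution c (m + (r * m + i))                   ≡⟨ shift-solution c (r * m + i) ⟩
    solution (monodromy c) (r * m + i)             ≡⟨ solution-iterate r (monodromy c) i ⟩
    solution (iterate monodromy (monodromy c) r) i ∎
    where open ≡-Reasoning

  solution-isPeriod : ∀ {r c} → 0 < r → iterate monodromy c r ≡ c → IsPeriod (r * m) (solution c)
  solution-isPeriod {suc r} {c} _ fix = ≤-trans (proj₁ S-period) (m≤m+n m (r * m)) , λ i → begin
    solution c (i + suc r * m)               ≡⟨ cong (solution c) (+-comm i (suc r * m)) ⟩
    solution c (suc r * m + i)               ≡⟨ solution-iterate (suc r) c i ⟩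
    solution (iterate monodromy c (suc r)) i ≡⟨ cong (λ x → solution x i) fix ⟩
    solution c i                             ∎
    where open ≡-Reasoning

-- Windows

module _ {X : Set} where

  prefix : ∀ n → (ℕ → X) → Vec X n
  prefix n f = tabulate (λ k → f (toℕ k))

  prefix-cong : ∀ n {f g : ℕ → X} → (∀ k → k < n → f k ≡ g k) → prefix n f ≡ prefix n g
  prefix-cong zero    e = refl
  prefix-cong (suc n) e = cong₂ _∷_ (e 0 z<s) (prefix-cong n (λ k k<n → e (suc k) (s<s k<n)))

  prefix-injective : ∀ n {f g : ℕ → X} → prefix n f ≡ prefix n g → ∀ k → k < n → f k ≡ g k
  prefix-injective (suc n) e zero    _         = ∷-injectiveˡ e
  prefix-injective (suc n) e (suc k) (s<s k<n) = prefix-injective n (∷-injectiveʳ e) k k<n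

  prefix-∷ʳ : ∀ n (f : ℕ → X) → prefix (suc n) f ≡ prefix n f ∷ʳ f n
  prefix-∷ʳ zero    f = refl
  prefix-∷ʳ (suc n) f = cong (f 0 ∷_) (prefix-∷ʳ n (λ k → f (suc k)))

  reverse-prefix : ∀ n (f : ℕ → X) → reverse (prefix n f) ≡ prefix n (λ k → f (n ∸ suc k))
  reverse-prefix zero    f = refl
  reverse-prefix (suc n) f = begin
    reverse (f 0 ∷ prefix n (λ k → f (suc k)))              ≡⟨ reverse-∷ (f 0) (prefix n (λ k → f (suc k))) ⟩
    reverse (prefix n (λ k → f (suc k))) ∷ʳ f 0             ≡⟨ cong (_∷ʳ f 0) (reverse-prefix n (λ k → f (suc k))) ⟩
    prefix n (λ k → f (suc (n ∸ suc k))) ∷ʳ f 0             ≡⟨ cong₂ _∷ʳ_ (prefix-cong n opposite) (cong f (sym (n∸n≡0 n))) ⟩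
    prefix n (λ k → f (suc n ∸ suc k)) ∷ʳ f (suc n ∸ suc n) ≡⟨ prefix-∷ʳ n (λ k → f (suc n ∸ suc k)) ⟨
    prefix (suc n) (λ k → f (suc n ∸ suc k))                ∎
    where
    open ≡-Reasoning
    opposite : ∀ k → k < n → f (suc (n ∸ suc k)) ≡ f (suc n ∸ suc k)
    opposite k k<n = cong f (sym (+-∸-assoc 1 k<n))

module Windows {q : ℕ} .{{_ : NonZero q}} (n : ℕ) where

  window-cong : ∀ {t u : Seq q} → t ≗ u → ∀ i → window n t i ≡ window n u i
  window-cong e i = tabulate-cong (λ k → e (i + toℕ k))

  window-head : ∀ (t u : Seq q) i j → window (suc n) t i ≡ window (suc n) u j → t i ≡ u j
  window-head t u i j e =
    trans (cong t (sym (+-identityʳ i))) (trans (∷-injectiveˡ e) (cong u (+-identityʳ j)))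

  window-A : ∀ (t u : Seq q) i j → window (suc n) t i ≡ window (suc n) u j → window n (A t) i ≡ window n (A u) j
  window-A t u i j e = prefix-cong n λ k k<n → begin
    t (i + k) +q t (suc (i + k)) ≡⟨ cong (t (i + k) +q_) (cong t (+-suc i k)) ⟨
    t (i + k) +q t (i + suc k)   ≡⟨ cong₂ _+q_ (agree k (m<n⇒m<1+n k<n)) (agree (suc k) (s<s k<n)) ⟩
    u (j + k) +q u (j + suc k)   ≡⟨ cong (u (j + k) +q_) (cong u (+-suc j k)) ⟩
    u (j + k) +q u (suc (j + k)) ∎
    where
    open ≡-Reasoning
    agree : ∀ k → k < suc n → t (i + k) ≡ u (j + k)
    agree = prefix-injective (suc n) e

  window-A-reverse : ∀ (t u : Seq q) i j → window (suc n) t i ≡ reverse (window (suc n) u j)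
                     → window n (A t) i ≡ reverse (window n (A u) j)
  window-A-reverse t u i j e = trans (prefix-cong n λ k k<n → begin
      t (i + k) +q t (suc (i + k))                     ≡⟨ cong (t (i + k) +q_) (cong t (+-suc i k)) ⟨
      t (i + k) +q t (i + suc k)                       ≡⟨ cong₂ _+q_ (agree k (m<n⇒m<1+n k<n)) (agree (suc k) (s<s k<n)) ⟩
      u (j + (n ∸ k)) +q u (j + (n ∸ suc k))           ≡⟨ +q-comm (u (j + (n ∸ k))) (u (j + (n ∸ suc k))) ⟩
      u (j + (n ∸ suc k)) +q u (j + (n ∸ k))           ≡⟨ cong (λ x → u (j + (n ∸ suc k)) +q u x) (opposite-suc k<n) ⟩
      u (j + (n ∸ suc k)) +q u (suc (j + (n ∸ suc k))) ∎)
    (sym (reverse-prefix n (λ k → A u (j + k))))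
    where
    open ≡-Reasoning
    agree : ∀ k → k < suc n → t (i + k) ≡ u (j + (n ∸ k))
    agree = prefix-injective (suc n) (trans e (reverse-prefix (suc n) (λ k → u (j + k))))
    opposite-suc : ∀ {k} → k < n → j + (n ∸ k) ≡ suc (j + (n ∸ suc k))
    opposite-suc k<n = trans (cong (j +_) (+-∸-assoc 1 k<n)) (+-suc j _)

module OrientableLift {q : ℕ} .{{_ : NonZero q}} (S : Seq q) (n m : ℕ) (S-orientable : IsOrientable n m S) where
  open Preimage S public
  open Monodromy S (proj₁ (proj₁ S-orientable)) public
  open Windows n

  private
    S-windows-injective : ∀ i j → window n S i ≡ window n S j → m ∣ ∣ i - j ∣
    S-windows-injective = proj₁ (proj₂ S-orientable)
    S-windows-irreversible : ∀ i j → window n S i ≢ reverse (window n S j)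
    S-windows-irreversible = proj₂ (proj₂ S-orientable)

  solution-windows : ∀ c c' i j → window (suc n) (solution c) i ≡ window (suc n) (solution c') j
                     → window n S i ≡ window n S j
  solution-windows c c' i j e = trans (sym (window-cong (solution-solves c) i))
    (trans (window-A (solution c) (solution c') i j e) (window-cong (solution-solves c') j))

  solution-irreversible : ∀ c c' i j → window (suc n) (solution c) i ≢ reverse (window (suc n) (solution c') j)
  solution-irreversible c c' i j e = S-windows-irreversible i j
    (trans (sym (window-cong (solution-solves c) i))
      (trans (window-A-reverse (solution c) (solution c') i j e)
        (cong reverse (window-cong (solution-solves c') j))))

  ordered-windows⇒orbit : ∀ c c' {i j} → i ≤ j → window (suc n) (solution c) i ≡ window (suc n) (solution c') j
                          → ∃ λ t → ∣ i - j ∣ ≡ t * m × c ≡ iterate monodromy c' t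
  ordered-windows⇒orbit c c' {i} {j} i≤j e
    with divides t ∣i-j∣≡t*m ← S-windows-injective i j (solution-windows c c' i j e) =
    t , ∣i-j∣≡t*m , solution-injective i (begin
      solution c i                        ≡⟨ window-head (solution c) (solution c') i j e ⟩
      solution c' j                       ≡⟨ cong (solution c') j≡t*m+i ⟩
      solution c' (t * m + i)             ≡⟨ solution-iterate t c' i ⟩
      solution (iterate monodromy c' t) i ∎)
    where
    open ≡-Reasoning
    j≡t*m+i : j ≡ t * m + i
    j≡t*m+i = trans (sym (m∸n+n≡m i≤j)) (cong (_+ i) (trans (sym (m≤n⇒∣m-n∣≡n∸m i≤j)) ∣i-j∣≡t*m))

  windows⇒orbit : ∀ c c' i j → window (suc n) (solution c) i ≡ window (suc n) (solution c') j
                  → ∃ λ t → ∣ i - j ∣ ≡ t * m × (c ≡ iterate monodromy c' t ⊎ c' ≡ iterate monodromy c t)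
  windows⇒orbit c c' i j e with ≤-total i j
  ... | inj₁ i≤j = let t , d , o = ordered-windows⇒orbit c c' i≤j e in t , d , inj₁ o
  ... | inj₂ j≤i = let t , d , o = ordered-windows⇒orbit c' c j≤i (sym e) in t , trans (∣-∣-comm i j) d , inj₂ o

  solution-orientable : ∀ {c r} → 0 < r → iterate monodromy c r ≡ c → (∀ t → iterate monodromy c t ≡ c → r ∣ t)
                        → IsOrientable (suc n) (r * m) (solution c)
  solution-orientable {c} {r} 0<r fix minimal =
    (solution-isPeriod 0<r fix , least) , windows-injective , solution-irreversible c c
    where
    windows-injective : ∀ i j → window (suc n) (solution c) i ≡ window (suc n) (solution c) j → r * m ∣ ∣ i - j ∣
    windows-injective i j e with t , ∣i-j∣≡t*m , o ← windows⇒orbit c c i j e =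
      subst (r * m ∣_) (sym ∣i-j∣≡t*m) (*-monoˡ-∣ m (minimal t (sym ([ id , id ]′ o))))
    least : ∀ p → IsPeriod p (solution c) → r * m ≤ p
    least p (0<p , p-period) = ∣⇒≤ {{>-nonZero 0<p}} (windows-injective 0 p
      (tabulate-cong (λ k → trans (sym (p-period (toℕ k))) (cong (solution c) (+-comm (toℕ k) p)))))

  solutions-oDisjoint : ∀ {c c'} → (∀ t → c ≢ iterate monodromy c' t) → (∀ t → c' ≢ iterate monodromy c t)
                        → ODisjoint (suc n) (solution c) (solution c')
  solutions-oDisjoint {c} {c'} apart apart' i j = different-orbits , solution-irreversible c c' i j
    where
    different-orbits : window (suc n) (solution c) i ≢ window (suc n) (solution c') j
    different-orbits e with t , _ , o ← windows⇒orbit c c' i j e = [ apart t , apart' t ]′ o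

-- The four cases

module OddPeriod {q : ℕ} .{{_ : NonZero q}} (S : Seq q) (n m : ℕ) (S-orientable : IsOrientable n m S)
                 (m-odd : m % 2 ≡ 1) where
  open OrientableLift S n m S-orientable public

  w : Fin q
  w = altWeight m S

  monodromy-reflect : ∀ c → monodromy c ≡ w +q (-q c)
  monodromy-reflect c =
    trans (monodromy≡altWeight+altSign c) (cong (w +q_) (trans (altSign-mod2 m c) (cong (λ i → altSign i c) m-odd)))

  monodromy-involutive : ∀ c → monodromy (monodromy c) ≡ c
  monodromy-involutive c = begin
    monodromy (monodromy c)      ≡⟨ monodromy-reflect (monodromy c) ⟩
    w +q (-q monodromy c)        ≡⟨ cong (λ x → w +q (-q x)) (monodromy-reflect c) ⟩
    w +q (-q (w +q (-q c)))      ≡⟨ cong (w +q_) (⁻¹-∙-comm w (-q c)) ⟨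
    w +q ((-q w) +q (-q (-q c))) ≡⟨ cong (λ x → w +q ((-q w) +q x)) (⁻¹-involutive c) ⟩
    w +q ((-q w) +q c)           ≡⟨ \\-leftDividesˡ w c ⟩
    c                            ∎
    where open ≡-Reasoning

  open Involution monodromy monodromy-involutive

  half-fixed : ∀ {c} → c +q c ≡ w → monodromy c ≡ c
  half-fixed {c} c+c≡w = trans (monodromy-reflect c) (trans (cong (_+q (-q c)) (sym c+c≡w)) (//-rightDividesʳ c c))

  sum≢w⇒apart : ∀ {a b} → a +q b ≢ w → a ≢ monodromy b
  sum≢w⇒apart {a} {b} a+b≢w a≡Fb =
    a+b≢w (trans (cong (_+q b) (trans a≡Fb (monodromy-reflect b))) (//-rightDividesˡ b w))

  solution-periodic : ∀ c → Periodic (solution c)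
  solution-periodic c = 2 * m , solution-isPeriod {2} (s≤s z≤n) (monodromy-involutive c)

  fixed-orientable : ∀ {c} → monodromy c ≡ c → IsOrientable (suc n) m (solution c)
  fixed-orientable {c} fix = subst (λ p → IsOrientable (suc n) p (solution c)) (*-identityˡ m)
    (solution-orientable (s≤s z≤n) fix (λ t _ → 1∣ t))

  moved-orientable : ∀ {c} → monodromy c ≢ c → IsOrientable (suc n) (2 * m) (solution c)
  moved-orientable {c} moved =
    solution-orientable (s≤s z≤n) (monodromy-involutive c) (iterate-moved-even moved)

  odd-listing : ∀ {K : Set} {k H} (fixed : K → Fin q) (moved : Fin H → Fin q)
    → Injective _≡_ _≡_ fixed → (∀ x → fixed x +q fixed x ≡ w)
    → Injective _≡_ _≡_ moved → (∀ j j' → moved j +q moved j' ≢ w)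
    → Fin k ↔ K → q ≡ k + H * 2
    → (∀ x → IsOrientable (suc n) m (solution (fixed x)))
      × (∀ j → IsOrientable (suc n) (2 * m) (solution (moved j)))
      × (∀ j j' → j ≢ j' → AltTranslate (solution (moved j)) (solution (moved j')))
      × ListsPreimage (K ⊎ (Fin H × Fin 2)) S
          [ solution ∘ fixed , shiftList (solution ∘ moved) (λ _ l → toℕ l * m) ]
  odd-listing {K} {k} {H} fixed moved fixed-injective fixed-half moved-injective moved-sum Fin-k↔K q≡k+H*2 =
      (λ x → fixed-orientable (half-fixed (fixed-half x)))
    , (λ j → moved-orientable (λ e → moved-apart j j (sym e)))
    , (λ j j' j≢j' → solution-altTranslate (λ e → j≢j' (moved-injective e)))
    , listsPreimage _ orbit-listing listed≗solution solution-periodic orbit-listing-injective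
        (↔-injective⇒surjective Fin-q↔I orbit-listing orbit-listing-injective)
    where
    moved-apart : ∀ j j' → moved j ≢ monodromy (moved j')
    moved-apart j j' = sum≢w⇒apart (moved-sum j j')
    open OrbitListing fixed moved fixed-injective (λ x → half-fixed (fixed-half x)) moved-injective moved-apart
    listed≗solution : ∀ x → [ solution ∘ fixed , shiftList (solution ∘ moved) (λ _ l → toℕ l * m) ] x
                              ≗ solution (orbit-listing x)
    listed≗solution (inj₁ x)       i = refl
    listed≗solution (inj₂ (j , l)) i = solution-iterate (toℕ l) (moved j) i
    Fin-q↔I : Fin q ↔ (K ⊎ (Fin H × Fin 2))
    Fin-q↔I = subst (λ N → Fin N ↔ (K ⊎ (Fin H × Fin 2))) (sym q≡k+H*2) (↔-trans +↔⊎ (Fin-k↔K ⊎-↔ *↔×))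

module EvenPeriod {q : ℕ} .{{_ : NonZero q}} (S : Seq q) (n m : ℕ) (S-orientable : IsOrientable n m S)
                  (m-even : m % 2 ≡ 0) {h : ℕ} (order : IsAddOrder h (altWeight m S)) where
  open OrientableLift S n m S-orientable public

  w : Fin q
  w = altWeight m S

  private
    instance
      h-nonZero : NonZero h
      h-nonZero = >-nonZero (proj₁ order)

  monodromy-translate : ∀ c → monodromy c ≡ w +q c
  monodromy-translate c =
    trans (monodromy≡altWeight+altSign c) (cong (w +q_) (trans (altSign-mod2 m c) (cong (λ i → altSign i c) m-even)))

  iterate-monodromy : ∀ t c → iterate monodromy c t ≡ (t ×q w) +q c
  iterate-monodromy zero    c = sym (+q-identityˡ c)
  iterate-monodromy (suc t) c = begin
    iterate monodromy (monodromy c) t ≡⟨ iterate-monodromy t (monodromy c) ⟩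
    (t ×q w) +q monodromy c           ≡⟨ cong ((t ×q w) +q_) (monodromy-translate c) ⟩
    (t ×q w) +q (w +q c)              ≡⟨ +q-assoc (t ×q w) w c ⟨
    ((t ×q w) +q w) +q c              ≡⟨ cong (_+q c) (+q-comm (t ×q w) w) ⟩
    (w +q (t ×q w)) +q c              ∎
    where open ≡-Reasoning

  iterate-order : ∀ c → iterate monodromy c h ≡ c
  iterate-order c = trans (iterate-monodromy h c) (trans (cong (_+q c) (order-annihilates order)) (+q-identityˡ c))

  iterate-fixed⇒order∣ : ∀ {c} t → iterate monodromy c t ≡ c → h ∣ t
  iterate-fixed⇒order∣ {c} t fix = order-divides order t
    (∙-cancelʳ c (t ×q w) 0q (trans (sym (iterate-monodromy t c)) (trans fix (sym (+q-identityˡ c)))))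

  k : ℕ
  k = q / h

  h∣q : h ∣ q
  h∣q = order-divides order q (∣⇒×q≡0q q w (m∣m*n (toℕ w)))

  k*h≡q : k * h ≡ q
  k*h≡q = m/n*n≡m h∣q

  k∣q : k ∣ q
  k∣q = divides h (trans (sym k*h≡q) (*-comm k h))

  k∣w : k ∣ toℕ w
  k∣w = *-cancelʳ-∣ h (subst (_∣ toℕ w * h) (sym k*h≡q) (subst (q ∣_) (*-comm h (toℕ w)) (proj₁ (proj₂ order))))

  private
    instance
      k-nonZero : NonZero k
      k-nonZero = >-nonZero (m≥n⇒m/n>0 (∣⇒≤ h∣q))

  -- Since k ∣ w, the orbits c + ⟨w⟩ are the residue classes modulo k, so 0, …, k-1 represent them.
  representative : Fin k → Fin q
  representative j = toℕ j mod q

  class : Fin q → ℕ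
  class c = toℕ c % k

  class-iterate : ∀ t c → class (iterate monodromy c t) ≡ class c
  class-iterate t c = trans (cong class (iterate-monodromy t c)) (toℕ[t×a+b]%k≡toℕ[b]%k k∣q w k∣w t c)

  class-representative : ∀ j → class (representative j) ≡ toℕ j
  class-representative j =
    trans (cong (_% k) (toℕ-mod (toℕ j))) (trans (m∣n⇒o%n%m≡o%m k q (toℕ j) k∣q) (m<n⇒m%n≡m (toℕ<n j)))

  listing : Fin k × Fin h → Fin q
  listing (j , l) = iterate monodromy (representative j) (toℕ l)

  class-listing : ∀ j l → class (listing (j , l)) ≡ toℕ j
  class-listing j l = trans (class-iterate (toℕ l) (representative j)) (class-representative j)

  listing-injective : Injective _≡_ _≡_ listing
  listing-injective {j , l} {j' , l'} e
    with refl ← toℕ-injective (trans (sym (class-listing j l)) (trans (cong class e) (class-listing j' l'))) =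
    cong (j ,_) (toℕ-injective (×q-injective-<order order (toℕ<n l) (toℕ<n l') (∙-cancelʳ (representative j) _ _
      (trans (sym (iterate-monodromy (toℕ l) _)) (trans e (iterate-monodromy (toℕ l') _))))))

  representatives-apart : ∀ {j j'} → j ≢ j' → ∀ t → representative j ≢ iterate monodromy (representative j') t
  representatives-apart {j} {j'} j≢j' t e = j≢j' (toℕ-injective
    (trans (sym (class-representative j)) (trans (cong class e) (trans (class-iterate t _) (class-representative j')))))

module _ {q : ℕ} .{{_ : NonZero q}} {n m : ℕ} {S : Seq q} (S-orientable : IsOrientable n m S) where

  preimage-m-odd-q-odd : m % 2 ≡ 1 → q % 2 ≡ 1
    → Σ (Seq q) λ T₀ → Σ (Fin ((q ∸ 1) / 2) → Seq q) λ U → Σ (Fin ((q ∸ 1) / 2) → Fin 2 → ℕ) λ a →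
        IsOrientable (suc n) m T₀
        × (∀ j → IsOrientable (suc n) (2 * m) (U j))
        × (∀ j j' → j ≢ j' → AltTranslate (U j) (U j'))
        × ListsPreimage (⊤ ⊎ (Fin ((q ∸ 1) / 2) × Fin 2)) S [ const T₀ , shiftList U a ]
  preimage-m-odd-q-odd m-odd q-odd =
    let fixed-orientable , moved-orientable , moved-translates , listed =
          odd-listing (λ _ → y) moved (λ _ → refl) (λ _ → y+y≡w) (shifted-injective y H<q) moved-sums 1↔⊤ q≡1+H*2
    in  solution y , solution ∘ moved , (λ _ l → toℕ l * m)
      , fixed-orientable tt , moved-orientable , moved-translates , listed
    where
    -- With 2y = w the reflection is y + d ↦ y - d: it fixes y and swaps y + (j+1) with y - (j+1), j < H.
    open OddPeriod S n m S-orientable m-odd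
    H : ℕ
    H = (q ∸ 1) / 2
    q≡1+H*2 : q ≡ 1 + H * 2
    q≡1+H*2 = odd-split q q-odd
    H<q : H < q
    H<q = subst (H <_) (sym q≡1+H*2) (s≤s (m≤m*n H 2))
    y : Fin q
    y = suc H ×q w
    y+y≡w : y +q y ≡ w
    y+y≡w = odd-halving H q≡1+H*2 w
    moved : Fin H → Fin q
    moved j = y +q (suc (toℕ j) mod q)
    moved-sums : ∀ j j' → moved j +q moved j' ≢ w
    moved-sums j j' = shifted-sum≢ (suc (toℕ j)) (suc (toℕ j')) (trans (+q-identityʳ (y +q y)) y+y≡w) refl z<s
      (subst (suc (toℕ j) + suc (toℕ j') <_) (sym q≡1+H*2) (s≤s (pair-sum-≤ (toℕ<n j) (toℕ<n j'))))

  preimage-m-odd-q-even-half : 2 ≤ q → m % 2 ≡ 1 → q % 2 ≡ 0 → (∃ λ x → x +q x ≡ altWeight m S)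
    → Σ (Fin 2 → Seq q) λ V → Σ (Fin ((q ∸ 2) / 2) → Seq q) λ U → Σ (Fin ((q ∸ 2) / 2) → Fin 2 → ℕ) λ a →
        (∀ l → IsOrientable (suc n) m (V l))
        × AltTranslate (V zero) (V (suc zero))
        × (∀ j → IsOrientable (suc n) (2 * m) (U j))
        × (∀ j j' → j ≢ j' → AltTranslate (U j) (U j'))
        × ListsPreimage (Fin 2 ⊎ (Fin ((q ∸ 2) / 2) × Fin 2)) S [ V , shiftList U a ]
  preimage-m-odd-q-even-half 2≤q m-odd q-even (x , x+x≡w) =
    let fixed-orientable , moved-orientable , moved-translates , listed =
          odd-listing fixed moved fixed-injective fixed-half (shifted-injective x H<q) moved-sums ↔-refl q≡2+H*2
    in  solution ∘ fixed , solution ∘ moved , (λ _ l → toℕ l * m)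
      , fixed-orientable , solution-altTranslate x≢x+z , moved-orientable , moved-translates , listed
    where
    -- With 2x = w the reflection x + d ↦ x - d fixes x and x + q/2 and swaps x ± (j+1), j < H.
    open OddPeriod S n m S-orientable m-odd
    H : ℕ
    H = (q ∸ 2) / 2
    q≡2+H*2 : q ≡ 2 + H * 2
    q≡2+H*2 = even-split₂ q 2≤q q-even
    q≡[1+H]+[1+H] : q ≡ suc H + suc H
    q≡[1+H]+[1+H] = trans q≡2+H*2 (cong suc (trans (cong suc (n*2≡n+n H)) (sym (+-suc H H))))
    1+H<q : suc H < q
    1+H<q = subst (suc H <_) (sym q≡[1+H]+[1+H]) (m<m+n (suc H) z<s)
    H<q : H < q
    H<q = <-trans (n<1+n H) 1+H<q
    z : Fin q
    z = suc H mod q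
    x≢x+z : x ≢ x +q z
    x≢x+z e = mod≢0q z<s 1+H<q (∙-cancelˡ x z 0q (trans (sym e) (sym (+q-identityʳ x))))
    fixed : Fin 2 → Fin q
    fixed zero       = x
    fixed (suc zero) = x +q z
    fixed-injective : Injective _≡_ _≡_ fixed
    fixed-injective {zero}     {zero}     _ = refl
    fixed-injective {zero}     {suc zero} e = contradiction e x≢x+z
    fixed-injective {suc zero} {zero}     e = contradiction (sym e) x≢x+z
    fixed-injective {suc zero} {suc zero} _ = refl
    fixed-half : ∀ l → fixed l +q fixed l ≡ w
    fixed-half zero       = x+x≡w
    fixed-half (suc zero) = begin
      (x +q z) +q (x +q z) ≡⟨ interchange x z x z ⟩
      (x +q x) +q (z +q z) ≡⟨ cong₂ _+q_ x+x≡w (even-halving-0q H q≡[1+H]+[1+H]) ⟩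
      w +q 0q              ≡⟨ +q-identityʳ w ⟩
      w                    ∎
      where open ≡-Reasoning
    moved : Fin H → Fin q
    moved j = x +q (suc (toℕ j) mod q)
    moved-sums : ∀ j j' → moved j +q moved j' ≢ w
    moved-sums j j' = shifted-sum≢ (suc (toℕ j)) (suc (toℕ j')) (trans (+q-identityʳ (x +q x)) x+x≡w) refl z<s
      (subst (suc (toℕ j) + suc (toℕ j') <_) (sym q≡2+H*2) (s≤s (m≤n⇒m≤1+n (pair-sum-≤ (toℕ<n j) (toℕ<n j')))))

  preimage-m-odd-q-even-no-half : m % 2 ≡ 1 → q % 2 ≡ 0 → ¬ (∃ λ x → x +q x ≡ altWeight m S)
    → Σ (Fin (q / 2) → Seq q) λ U → Σ (Fin (q / 2) → Fin 2 → ℕ) λ a →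
        (∀ j → IsOrientable (suc n) (2 * m) (U j))
        × (∀ j j' → j ≢ j' → AltTranslate (U j) (U j'))
        × ListsPreimage (Fin (q / 2) × Fin 2) S (shiftList U a)
  preimage-m-odd-q-even-no-half m-odd q-even no-half =
    let _ , moved-orientable , moved-translates , listed =
          odd-listing (λ ()) moved (λ {}) (λ ()) (shifted-injective y H<q) moved-sums 0↔⊥ q≡H*2
    in solution ∘ moved , (λ _ l → toℕ l * m) , moved-orientable , moved-translates , listsPreimage-⊥⊎ listed
    where
    -- With 2y + 1 = w the reflection y + d ↦ y + 1 - d has no fixed point and swaps y + (j+1) with y - j.
    open OddPeriod S n m S-orientable m-odd
    H : ℕ
    H = q / 2
    q≡H*2 : q ≡ H * 2
    q≡H*2 = sym (m/n*n≡m (m%n≡0⇒n∣m q 2 q-even))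
    H<q : H < q
    H<q = m/n<m q 2 (s≤s (s≤s z≤n))
    W : ℕ
    W = toℕ w
    y : Fin q
    y = (W / 2) mod q
    W-odd : W % 2 ≡ 1
    W-odd with W % 2 | mod-halving {q} W | m%n<n W 2
    ... | zero     | y+y+0≡w | _ = contradiction (y , trans (sym (+q-identityʳ (y +q y))) (trans y+y+0≡w (mod-toℕ w))) no-half
    ... | suc zero | _       | _ = refl
    ... | suc (suc _) | _    | s≤s (s≤s ())
    y+y+1≡w : (y +q y) +q (1 mod q) ≡ w
    y+y+1≡w = trans (cong (λ r → (y +q y) +q (r mod q)) (sym W-odd)) (trans (mod-halving W) (mod-toℕ w))
    moved : Fin H → Fin q
    moved j = y +q (suc (toℕ j) mod q)
    moved-sums : ∀ j j' → moved j +q moved j' ≢ w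
    moved-sums j j' = shifted-sum≢ (suc (toℕ j)) (suc (toℕ j')) y+y+1≡w (cong suc (+-suc (toℕ j) (toℕ j'))) z<s
      (subst (suc (toℕ j + toℕ j') <_) (sym q≡H*2)
        (≤-trans (+-mono-≤-< (toℕ<n j) (toℕ<n j')) (≤-reflexive (sym (n*2≡n+n H)))))

  preimage-m-even : m % 2 ≡ 0 → (h : ℕ) → IsAddOrder h (altWeight m S)
    → Σ ℕ λ k → k * h ≡ q × Σ (Fin k → Seq q) λ U → Σ (Fin k → Fin h → ℕ) λ a →
        (∀ j → IsOrientable (suc n) (h * m) (U j))
        × (∀ j j' → j ≢ j' → ODisjoint (suc n) (U j) (U j'))
        × (∀ j j' → j ≢ j' → AltTranslate (U j) (U j'))
        × ListsPreimage (Fin k × Fin h) S (shiftList U a)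
  preimage-m-even m-even h order =
      k , k*h≡q , solution ∘ representative , (λ _ l → toℕ l * m)
    , (λ j → solution-orientable (proj₁ order) (iterate-order _) iterate-fixed⇒order∣)
    , (λ j j' j≢j' → solutions-oDisjoint (representatives-apart j≢j') (representatives-apart (j≢j' ∘ sym)))
    , (λ j j' j≢j' → solution-altTranslate (representatives-apart j≢j' 0))
    , listsPreimage _ listing (λ (j , l) → solution-iterate (toℕ l) (representative j))
        (λ c → h * m , solution-isPeriod (proj₁ order) (iterate-order c)) listing-injective
        (↔-injective⇒surjective (subst (λ N → Fin N ↔ (Fin k × Fin h)) k*h≡q *↔×) listing listing-injective)
    where open EvenPeriod S n m S-orientable m-even order

theorem8 : (q : ℕ) .{{_ : NonZero q}} → 2 ≤ q → (n : ℕ) → 1 ≤ n → (m : ℕ) → (S : Seq q) → IsOrientable n m S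
  → ((m % 2 ≡ 1) → (q % 2 ≡ 1)
      → Σ (Seq q) λ T₀ → Σ (Fin ((q ∸ 1) / 2) → Seq q) λ U → Σ (Fin ((q ∸ 1) / 2) → Fin 2 → ℕ) λ a →
          IsOrientable (suc n) m T₀
          × (∀ j → IsOrientable (suc n) (2 * m) (U j))
          × (∀ j j' → j ≢ j' → AltTranslate (U j) (U j'))
          × ListsPreimage (⊤ ⊎ (Fin ((q ∸ 1) / 2) × Fin 2)) S [ const T₀ , shiftList U a ])
  × ((m % 2 ≡ 1) → (q % 2 ≡ 0) → (∃ λ x → x +q x ≡ altWeight m S)
      → Σ (Fin 2 → Seq q) λ V → Σ (Fin ((q ∸ 2) / 2) → Seq q) λ U → Σ (Fin ((q ∸ 2) / 2) → Fin 2 → ℕ) λ a →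
          (∀ l → IsOrientable (suc n) m (V l))
          × AltTranslate (V zero) (V (suc zero))
          × (∀ j → IsOrientable (suc n) (2 * m) (U j))
          × (∀ j j' → j ≢ j' → AltTranslate (U j) (U j'))
          × ListsPreimage (Fin 2 ⊎ (Fin ((q ∸ 2) / 2) × Fin 2)) S [ V , shiftList U a ])
  × ((m % 2 ≡ 1) → (q % 2 ≡ 0) → ¬ (∃ λ x → x +q x ≡ altWeight m S)
      → Σ (Fin (q / 2) → Seq q) λ U → Σ (Fin (q / 2) → Fin 2 → ℕ) λ a →
          (∀ j → IsOrientable (suc n) (2 * m) (U j))
          × (∀ j j' → j ≢ j' → AltTranslate (U j) (U j'))
          × ListsPreimage (Fin (q / 2) × Fin 2) S (shiftList U a))
  × ((m % 2 ≡ 0) → (h : ℕ) → IsAddOrder h (altWeight m S)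
      → Σ ℕ λ k → k * h ≡ q × Σ (Fin k → Seq q) λ U → Σ (Fin k → Fin h → ℕ) λ a →
          (∀ j → IsOrientable (suc n) (h * m) (U j))
          × (∀ j j' → j ≢ j' → ODisjoint (suc n) (U j) (U j'))
          × (∀ j j' → j ≢ j' → AltTranslate (U j) (U j'))
          × ListsPreimage (Fin k × Fin h) S (shiftList U a))
theorem8 q 2≤q n _ m S S-orientable =
    preimage-m-odd-q-odd S-orientable
  , preimage-m-odd-q-even-half S-orientable 2≤q
  , preimage-m-odd-q-even-no-half S-orientable
  , preimage-m-even S-orientable
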